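{- Let $\mathcal{L}$ be a finite relational signature, $\mathscr{D}$ a nonprincipal ultrafilter over $\omega$, and $(\mathcal{M}_t)_{t\in\omega}$ a $\mathscr{D}$-trending sequence of finite $\mathcal{L}$-structures; put $\mathfrak{M}^*:=\prod_{t\in\omega}\mathcal{M}_t/\mathscr{D}$. Let $\mathcal{A}$ be a finite substructure of $\mathfrak{M}^*$ with $n:=|A|$, let $k\in\omega$, and fix an internal $k$-coloring $c^*$ of the copies of $\mathcal{A}$ in $\mathfrak{M}^*$. Let $\widehat{\mathcal{L}}$ be the signature consisting of $\mathcal{L}$ together with a new $n$-ary function symbol $f$ and new constant symbols $e_0,\dots,e_{k-1}$. Then there exist $\widehat{\mathcal{L}}$-expansions $\widehat{\mathcal{M}}_t$ of $\mathcal{M}_t$, $t\in\omega$, such that, writing $\widehat{\mathfrak{M}^*}:=\prod_{t\in\omega}\widehat{\mathcal{M}}_t/\mathscr{D}$, for every copy $\mathcal{A}'$ of $\mathcal{A}$ in $\mathfrak{M}^*$, every enumeration $\overline{b}$ of the underlying set of $\mathcal{A}'$, and every $j\in k$, we have $f^{\widehat{\mathfrak{M}^*}}(\overline{b})=e_j^{\widehat{\mathfrak{M}^*}}$ if and only if $c^*(\mathcal{A}')=j$.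
   Context: Copies of $\mathcal{A}$ in a structure are its substructures isomorphic to $\mathcal{A}$; a $k$-coloring of copies is a map from the set of copies to $k=\{0,\dots,k-1\}$. A sequence $(\mathcal{M}_t)$ is $\mathscr{D}$-trending if $|M_s|\le|M_t|$ for $s<t$, $\lim_t|M_t|=\infty$, and $\{t:\mathcal{M}_i \text{ embeds into } \mathcal{M}_t\}\in\mathscr{D}$ for each $i\in\omega$. For $a\in\mathfrak{M}^*$, $a[t]$ is the $t$-th coordinate of a representative in $\prod_tM_t$; for a finite substructure $\mathcal{A}'$ of $\mathfrak{M}^*$, $\mathcal{A}'[t]$ is the substructure of $\mathcal{M}_t$ on $\{a[t]:a\in A'\}$. A $k$-coloring $c^*$ of the copies of $\mathcal{A}$ in $\mathfrak{M}^*$ is internal if there exist $Z\in\mathscr{D}$ and $k$-colorings $c_t$ of the copies of $\mathcal{A}$ in $\mathcal{M}_t$ ($t\in Z$) such that for every copy $\mathcal{A}'$ and $j\in k$: $c^*(\mathcal{A}')=j$ iff $\{t\in Z:\mathcal{A}'[t]\cong\mathcal{A}' \text{ and } c_t(\mathcal{A}'[t])=j\}\in\mathscr{D}$. -}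

module Defs where

open import Data.Nat using (ℕ; _≤_; _<_)
open import Data.Fin using (Fin)
open import Data.Bool using (Bool; true)
open import Data.Unit using (⊤)
open import Data.Empty using (⊥)
open import Data.Product using (Σ; ∃; ∃-syntax; _×_)
open import Data.Sum using (_⊎_)
open import Relation.Nullary using (¬_)
open import Relation.Binary.PropositionalEquality using (_≡_)
open import Function using (_∘_; Injective)
open import Function.Bundles using (_⤖_; _⇔_; Bijection)

record Sig : Set where
  field
    nrel : ℕ
    ar   : Fin nrel → ℕ
open Sig public

-- A finite L-structure with universe Fin size (nonempty, as usual in
-- model theory); relations are decidable (Bool-valued) predicates on tuples.
record FinStr (L : Sig) : Set where
  field
    size     : ℕ
    nonempty : 1 ≤ size
    rel      : (i : Fin (nrel L)) → (Fin (ar L i) → Fin size) → Bool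
open FinStr public

-- An interpretation of the relation symbols of L on a carrier X
-- (Set-valued, used for substructures of the ultraproduct).
Rels : Sig → Set → Set₁
Rels L X = (i : Fin (nrel L)) → (Fin (ar L i) → X) → Set

Iso : {L : Sig} {n : ℕ} → Rels L (Fin n) → Rels L (Fin n) → Set
Iso {L} {n} R S =
  Σ (Fin n ⤖ Fin n) λ σ →
    (i : Fin (nrel L)) (ā : Fin (ar L i) → Fin n) →
      R i ā ⇔ S i (Bijection.to σ ∘ ā)

Embeds : {L : Sig} → FinStr L → FinStr L → Set
Embeds {L} M N =
  Σ (Fin (size M) → Fin (size N)) λ h →
    Injective _≡_ _≡_ h ×
    ((i : Fin (nrel L)) (ā : Fin (ar L i) → Fin (size M)) →
      rel M i ā ≡ rel N i (h ∘ ā))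

record IsUltrafilter (D : (ℕ → Set) → Set) : Set₁ where
  field
    full  : D (λ _ → ⊤)
    empty : ¬ D (λ _ → ⊥)
    mono  : {X Y : ℕ → Set} → (∀ t → X t → Y t) → D X → D Y
    inter : {X Y : ℕ → Set} → D X → D Y → D (λ t → X t × Y t)
    ultra : (X : ℕ → Set) → D X ⊎ D (λ t → ¬ X t)

NonPrincipal : ((ℕ → Set) → Set) → Set
NonPrincipal D = (n : ℕ) → ¬ D (λ t → t ≡ n)

Trending : {L : Sig} → ((ℕ → Set) → Set) → (ℕ → FinStr L) → Set
Trending D Ms =
  ((s t : ℕ) → s < t → size (Ms s) ≤ size (Ms t)) ×
  ((N : ℕ) → ∃[ T ] ((t : ℕ) → T ≤ t → N ≤ size (Ms t))) ×
  ((i : ℕ) → D (λ t → Embeds (Ms i) (Ms t)))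

module Ultraproduct (L : Sig) (D : (ℕ → Set) → Set) (Ms : ℕ → FinStr L) where

  -- representatives of elements of 𝔐*
  Elem : Set
  Elem = (t : ℕ) → Fin (size (Ms t))

  _≈*_ : Elem → Elem → Set
  a ≈* b = D (λ t → a t ≡ b t)

  Rel* : Rels L Elem
  Rel* i ā = D (λ t → rel (Ms t) i (λ p → ā p t) ≡ true)

  InjEnum : {n : ℕ} → (Fin n → Elem) → Set
  InjEnum {n} b = (p q : Fin n) → b p ≈* b q → p ≡ q

  -- induced substructure of 𝔐* on the set enumerated by b
  -- (coordinatized through the enumeration)
  Induced : {n : ℕ} → (Fin n → Elem) → Rels L (Fin n)
  Induced b i ā = Rel* i (b ∘ ā)

  SameSet : {n : ℕ} → (Fin n → Elem) → (Fin n → Elem) → Set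
  SameSet {n} b b' =
    ((p : Fin n) → ∃[ q ] (b p ≈* b' q)) × ((q : Fin n) → ∃[ p ] (b p ≈* b' q))

  -- A finite substructure 𝒜 of 𝔐*, with |A| = n, is given by an
  -- injective enumeration el : Fin n → Elem of its universe.
  -- b enumerates (the universe of) a copy of 𝒜 in 𝔐*:
  -- b is injective and the induced substructure on its image is ≅ 𝒜.
  IsCopy : {n : ℕ} → (el : Fin n → Elem) → (Fin n → Elem) → Set
  IsCopy el b = InjEnum b × Iso (Induced el) (Induced b)

  -- a k-coloring of the copies of 𝒜 in 𝔐*: a map on copies, i.e. on
  -- enumerations of copies, depending only on the underlying set.
  record Coloring* {n : ℕ} (el : Fin n → Elem) (k : ℕ) : Set where
    field
      col : (b : Fin n → Elem) → IsCopy el b → Fin k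
      welldef : (b b' : Fin n → Elem) (p : IsCopy el b) (p' : IsCopy el b') →
                SameSet b b' → col b p ≡ col b' p'
  open Coloring* public

  IsCopyₜ : {n : ℕ} → (el : Fin n → Elem) → (t : ℕ) → (Fin n → Fin (size (Ms t))) → Set
  IsCopyₜ el t u =
    Injective _≡_ _≡_ u ×
    Iso (Induced el) (λ i ā → rel (Ms t) i (u ∘ ā) ≡ true)

  SameSetₜ : {n : ℕ} (t : ℕ) → (Fin n → Fin (size (Ms t))) → (Fin n → Fin (size (Ms t))) → Set
  SameSetₜ {n} t u u' =
    ((p : Fin n) → ∃[ q ] (u p ≡ u' q)) × ((q : Fin n) → ∃[ p ] (u p ≡ u' q))

  record Coloringₜ {n : ℕ} (el : Fin n → Elem) (k : ℕ) (t : ℕ) : Set where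
    field
      colₜ : (u : Fin n → Fin (size (Ms t))) → IsCopyₜ el t u → Fin k
      welldefₜ : (u u' : Fin n → Fin (size (Ms t)))
                 (p : IsCopyₜ el t u) (p' : IsCopyₜ el t u') →
                 SameSetₜ t u u' → colₜ u p ≡ colₜ u' p'
  open Coloringₜ public

  _[_] : {n : ℕ} → (Fin n → Elem) → (t : ℕ) → Fin n → Fin (size (Ms t))
  (b [ t ]) p = b p t

  Internal : {n : ℕ} {el : Fin n → Elem} {k : ℕ} → Coloring* el k → Set₁
  Internal {n} {el} {k} c* =
    Σ (ℕ → Set) λ Z → D Z ×
    Σ ((t : ℕ) → Z t → Coloringₜ el k t) λ c →
      (b : Fin n → Elem) (p : IsCopy el b) (j : Fin k) →
        (col c* b p ≡ j) ⇔
        D (λ t → Σ (Z t) λ z → Σ (IsCopyₜ el t (b [ t ])) λ q →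
                   colₜ (c t z) (b [ t ]) q ≡ j)

-- In each M_t let f send a tuple to the point e_j when c_t colours it j, and to a
-- default point otherwise; the points e_0, …, e_{k-1} are distinct as soon as
-- |M_t| ≥ k, which holds D-almost everywhere because the sequence is trending and D
-- is nonprincipal.  Then f(b̄) = e_j holds in the ultraproduct iff D-almost every
-- b̄[t] is a copy coloured j by c_t, iff c*(A') = j by internality.
-- Whether a tuple of M_t carries colour j need not be decidable here, but an
-- ultrafilter decides ¬ P for every proposition P, which suffices to select, at
-- each t, a colour j such that ¬ ¬ (the tuple carries colour j).
module Submission where

open import Defs
open import Data.Nat using (ℕ; zero; suc; _≤_; z≤n; >-nonZero)
open import Data.Nat.Properties using (≤∧≢⇒<; <-≤-trans)
open import Data.Nat.DivMod using (_mod_; m<n⇒m%n≡m)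
open import Data.Fin using (Fin; toℕ; fromℕ<; _≟_)
open import Data.Fin.Properties using (any?; toℕ-fromℕ<; toℕ-injective; toℕ<n)
open import Data.Product using (Σ; _,_; proj₁; proj₂)
open import Data.Sum using (inj₁; inj₂)
open import Relation.Nullary using (¬_; Dec; yes; no; contradiction)
open import Relation.Nullary.Decidable using (¬?; decidable-stable)
open import Relation.Binary.PropositionalEquality using (_≡_; _≢_; refl; sym; trans; cong; module ≡-Reasoning)
open import Function using (_∘_)
open import Function.Bundles using (_⇔_; mk⇔; Equivalence)

module UltrafilterProperties {D : (ℕ → Set) → Set} (U : IsUltrafilter D) where
  open IsUltrafilter U

  ¬-dec : (P : Set) → Dec (¬ P)
  ¬-dec P with ultra (λ _ → P)
  ... | inj₁ dP  = no λ ¬p → empty (mono (λ _ → ¬p) dP)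
  ... | inj₂ d¬P = yes λ p → empty (mono (λ _ ¬p → ¬p p) d¬P)

  complement : {X : ℕ → Set} → ¬ D X → D (λ t → ¬ X t)
  complement {X} ¬dX with ultra X
  ... | inj₁ dX  = contradiction dX ¬dX
  ... | inj₂ d∁X = d∁X

  const-stable : {P : Set} → Dec P → D (λ _ → P) → P
  const-stable P? dP = decidable-stable P? λ ¬p → empty (mono (λ _ → ¬p) dP)

  ⋂-Fin : {k : ℕ} {X : Fin k → ℕ → Set} → ((j : Fin k) → D (X j)) →
          D (λ t → (j : Fin k) → X j t)
  ⋂-Fin {zero}  _  = mono (λ _ _ ()) full
  ⋂-Fin {suc k} dX = mono (λ { _ (x₀ , xs) Fin.zero → x₀ ; _ (x₀ , xs) (Fin.suc j) → xs j })
                          (inter (dX Fin.zero) (⋂-Fin (dX ∘ Fin.suc)))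

  final-segment : NonPrincipal D → (T : ℕ) → D (λ t → T ≤ t)
  final-segment _ zero = mono (λ _ _ → z≤n) full
  final-segment nonPrincipal (suc T) =
    mono (λ _ (T≤t , t≢T) → ≤∧≢⇒< T≤t (t≢T ∘ sym))
         (inter (final-segment nonPrincipal T) (complement (nonPrincipal T)))

  trending⇒large : {L : Sig} {Ms : ℕ → FinStr L} → NonPrincipal D → Trending D Ms →
                   (m : ℕ) → D (λ t → m ≤ size (Ms t))
  trending⇒large nonPrincipal (_ , unbounded , _) m with unbounded m
  ... | T , large = mono large (final-segment nonPrincipal T)

module _ {A : Set} {k : ℕ} {P : Fin k → Set} where

  select : ((j : Fin k) → Dec (P j)) → (Fin k → A) → A → A
  select P? e a with any? P?
  ... | yes (j , _) = e j
  ... | no _        = a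

  select-unique : (P? : (j : Fin k) → Dec (P j)) (e : Fin k → A) (a : A) {j₀ : Fin k} →
                  P j₀ → ((j : Fin k) → j ≢ j₀ → ¬ P j) → select P? e a ≡ e j₀
  select-unique P? e a {j₀} pj₀ onlyj₀ with any? P?
  ... | no ¬∃P = contradiction (j₀ , pj₀) ¬∃P
  ... | yes (j , pj) with j ≟ j₀
  ...   | yes refl = refl
  ...   | no j≢j₀  = contradiction pj (onlyj₀ j j≢j₀)

module _ {L : Sig} {k : ℕ} where

  colourPoint : (M : FinStr L) → Fin k → Fin (size M)
  colourPoint M j = _mod_ (toℕ j) (size M) {{>-nonZero (nonempty M)}}

  toℕ-colourPoint : (M : FinStr L) → k ≤ size M → (j : Fin k) → toℕ (colourPoint M j) ≡ toℕ j
  toℕ-colourPoint M k≤m j =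
    trans (toℕ-fromℕ< _) (m<n⇒m%n≡m {{>-nonZero (nonempty M)}} (<-≤-trans (toℕ<n j) k≤m))

  colourPoint-injective : (M : FinStr L) → k ≤ size M → (i j : Fin k) →
                          colourPoint M i ≡ colourPoint M j → i ≡ j
  colourPoint-injective M k≤m i j eq = toℕ-injective (begin
    toℕ i                   ≡⟨ toℕ-colourPoint M k≤m i ⟨
    toℕ (colourPoint M i)   ≡⟨ cong toℕ eq ⟩
    toℕ (colourPoint M j)   ≡⟨ toℕ-colourPoint M k≤m j ⟩
    toℕ j                   ∎)
    where open ≡-Reasoning

module ColourExpansion {L : Sig} {D : (ℕ → Set) → Set} (U : IsUltrafilter D)
  (Ms : ℕ → FinStr L) {n : ℕ} (el : Fin n → Ultraproduct.Elem L D Ms) {k : ℕ}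
  (c* : Ultraproduct.Coloring* L D Ms el k) (internal : Ultraproduct.Internal L D Ms c*) where
  open IsUltrafilter U
  open UltrafilterProperties U
  open Ultraproduct L D Ms

  Z : ℕ → Set
  Z = proj₁ internal

  c : (t : ℕ) → Z t → Coloringₜ el k t
  c = proj₁ (proj₂ (proj₂ internal))

  ColouredAt : (t : ℕ) → (Fin n → Fin (size (Ms t))) → Fin k → Set
  ColouredAt t u j = Σ (Z t) λ z → Σ (IsCopyₜ el t u) λ q → colₜ (c t z) u q ≡ j

  col*≡⇔ColouredAt : (b : Fin n → Elem) (p : IsCopy el b) (j : Fin k) →
                     (col c* b p ≡ j) ⇔ D (λ t → ColouredAt t (b [ t ]) j)
  col*≡⇔ColouredAt = proj₂ (proj₂ (proj₂ internal))

  ¬¬ColouredAt? : (t : ℕ) (u : Fin n → Fin (size (Ms t))) (j : Fin k) → Dec (¬ ¬ ColouredAt t u j)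
  ¬¬ColouredAt? t u j = ¬? (¬-dec (ColouredAt t u j))

  e : (t : ℕ) → Fin k → Fin (size (Ms t))
  e t = colourPoint (Ms t)

  f : (t : ℕ) → (Fin n → Fin (size (Ms t))) → Fin (size (Ms t))
  f t u = select (¬¬ColouredAt? t u) (e t) (fromℕ< (nonempty (Ms t)))

  onlyColour : (b : Fin n → Elem) (p : IsCopy el b) (j : Fin k) →
               D (λ t → j ≢ col c* b p → ¬ ColouredAt t (b [ t ]) j)
  onlyColour b p j with j ≟ col c* b p
  ... | yes j≡ = mono (λ _ _ j≢ → contradiction j≡ j≢) full
  ... | no j≢  = mono (λ _ ¬q _ → ¬q)
                      (complement (j≢ ∘ sym ∘ Equivalence.from (col*≡⇔ColouredAt b p j)))

  f-colours : (b : Fin n → Elem) (p : IsCopy el b) →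
              D (λ t → f t (b [ t ]) ≡ e t (col c* b p))
  f-colours b p =
    mono (λ t (coloured , uncoloured) →
            select-unique (¬¬ColouredAt? t (b [ t ])) (e t) _
              (λ ¬q → ¬q coloured) (λ j j≢ ¬¬q → ¬¬q (uncoloured j j≢)))
         (inter (Equivalence.to (col*≡⇔ColouredAt b p (col c* b p)) refl)
                (⋂-Fin (onlyColour b p)))

  f≡e⇔col*≡ : NonPrincipal D → Trending D Ms →
              (b : Fin n → Elem) (p : IsCopy el b) (j : Fin k) →
              D (λ t → f t (b [ t ]) ≡ e t j) ⇔ (col c* b p ≡ j)
  f≡e⇔col*≡ nonPrincipal trending b p j = mk⇔ col*≡ (λ { refl → f-colours b p })
    where
    col*≡ : D (λ t → f t (b [ t ]) ≡ e t j) → col c* b p ≡ j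
    col*≡ fb≡ej = const-stable (col c* b p ≟ j)
      (mono (λ t (fb≡ej , fb≡ecol , k≤m) →
               colourPoint-injective (Ms t) k≤m (col c* b p) j (trans (sym fb≡ecol) fb≡ej))
            (inter fb≡ej (inter (f-colours b p) (trending⇒large {Ms = Ms} nonPrincipal trending k))))

proposition4p4 : (L : Sig) (D : (ℕ → Set) → Set) → IsUltrafilter D → NonPrincipal D →
    (Ms : ℕ → FinStr L) → Trending D Ms →
    (n : ℕ) (el : Fin n → Ultraproduct.Elem L D Ms) → Ultraproduct.InjEnum L D Ms el →
    (k : ℕ) (c* : Ultraproduct.Coloring* L D Ms el k) → Ultraproduct.Internal L D Ms c* →
    Σ ((t : ℕ) → (Fin n → Fin (size (Ms t))) → Fin (size (Ms t))) λ f →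
    Σ ((t : ℕ) → Fin k → Fin (size (Ms t))) λ e →
      (b : Fin n → Ultraproduct.Elem L D Ms) (p : Ultraproduct.IsCopy L D Ms el b) (j : Fin k) →
        D (λ t → f t (λ q → b q t) ≡ e t j) ⇔ (Ultraproduct.col c* b p ≡ j)
proposition4p4 L D U nonPrincipal Ms trending n el _ k c* internal =
  f , e , f≡e⇔col*≡ nonPrincipal trending
  where open ColourExpansion U Ms el c* internal
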